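{- Let $t,k,r$ be positive integers with $t\le k\le r-t$, and let $\Omega=S_k^{r-1}=\{(x_1,\ldots,x_r)\in\{0,1\}^r : \sum_{i=1}^r x_i^2=k\}$. Let $A=\{\mathbf{a}_1,\ldots,\mathbf{a}_n\}$, $B=\{\mathbf{b}_1,\ldots,\mathbf{b}_n\}$ be multisets of points of $\Omega$ such that $(A,B)$ is a proper $\mathrm{PTE}_r$ solution of degree $2t$ and size $n$. Let $\mathbf{t}_1,\ldots,\mathbf{t}_d$ be a basis of $\mathcal{P}_t(\Omega)$, $d=\dim_{\mathbb{Q}}\mathcal{P}_t(\Omega)$, let $N_A=(\mathbf{t}_i(\mathbf{a}_j))$, $N_B=(\mathbf{t}_i(\mathbf{b}_j))$ (both $d\times n$), and suppose $\operatorname{rank}[N_A\;N_B]=d$. Then $n\ge\binom{r}{t}$.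
   Context: For multisets $A=\{\mathbf{a}_1,\ldots,\mathbf{a}_n\}$, $B=\{\mathbf{b}_1,\ldots,\mathbf{b}_n\}$ of vectors in $\mathbb{Q}^r$, with $\mathbf{a}_i=(a_{i1},\ldots,a_{ir})$, $\mathbf{b}_i=(b_{i1},\ldots,b_{ir})$, $(A,B)$ is a $\mathrm{PTE}_r$ solution of degree $m$ and size $n$ if $A$ and $B$ have no element in common and $\sum_{i=1}^n\prod_{j=1}^r a_{ij}^{k_j}=\sum_{i=1}^n\prod_{j=1}^r b_{ij}^{k_j}$ for all nonnegative integers $k_1,\ldots,k_r$ with $1\le k_1+\cdots+k_r\le m$. It is (combinatorially) proper if, regarding $A,B$ as $n\times r$ matrices with rows $\mathbf{a}_i$ resp. $\mathbf{b}_i$, $\operatorname{rank}A=\operatorname{rank}B=r$. $\mathcal{P}_t(\Omega)$ is the $\mathbb{Q}$-vector space of functions on $\Omega$ that are restrictions of rational polynomials in $r$ variables of degree at most $t$. -}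

module Defs where

open import Data.Nat as ℕ using (ℕ; zero; suc; _≤_; _∸_)
open import Data.Integer using (+_)
open import Data.Rational using (ℚ; 0ℚ; 1ℚ; _+_; _*_; _/_)
open import Data.Fin using (Fin; zero; suc; splitAt)
open import Data.Vec using (Vec; lookup)
open import Data.List using (List)
open import Data.List.Relation.Unary.All using (All)
open import Data.Sum using (_⊎_; [_,_]′)
open import Data.Product using (Σ; _×_; _,_; ∃; proj₁; proj₂)
open import Relation.Binary.PropositionalEquality using (_≡_; _≢_)
open import Relation.Nullary using (¬_)

ℕ→ℚ : ℕ → ℚ
ℕ→ℚ k = + k / 1

_^ℚ_ : ℚ → ℕ → ℚ
x ^ℚ zero = 1ℚ
x ^ℚ suc e = x * (x ^ℚ e)

Σℚ : (m : ℕ) → (Fin m → ℚ) → ℚ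
Σℚ zero f = 0ℚ
Σℚ (suc m) f = f zero + Σℚ m (λ i → f (suc i))

Πℚ : (m : ℕ) → (Fin m → ℚ) → ℚ
Πℚ zero f = 1ℚ
Πℚ (suc m) f = f zero * Πℚ m (λ i → f (suc i))

Σℕ : (m : ℕ) → (Fin m → ℕ) → ℕ
Σℕ zero f = 0
Σℕ (suc m) f = f zero ℕ.+ Σℕ m (λ i → f (suc i))

∣_∣ₑ : ∀ {r} → Vec ℕ r → ℕ
∣_∣ₑ {r} e = Σℕ r (lookup e)

monomial : ∀ {r} → Vec ℕ r → Vec ℚ r → ℚ
monomial {r} e x = Πℚ r (λ j → lookup x j ^ℚ lookup e j)

LinIndep : ∀ {m p} → (Fin m → Fin p → ℚ) → Set
LinIndep {m} {p} v =
  (c : Fin m → ℚ) → (∀ j → Σℚ m (λ i → c i * v i j) ≡ 0ℚ) → ∀ i → c i ≡ 0ℚ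

cols : ∀ {m p ρ} → (Fin m → Fin p → ℚ) → (Fin ρ → Fin p) → Fin ρ → Fin m → ℚ
cols M s l i = M i (s l)

HasRank : ∀ {m p} → (Fin m → Fin p → ℚ) → ℕ → Set
HasRank {m} {p} M ρ =
  (Σ (Fin ρ → Fin p) λ s → LinIndep (cols M s)) ×
  ((s : Fin (suc ρ) → Fin p) → ¬ LinIndep (cols M s))

rowsMatrix : ∀ {n r} → (Fin n → Vec ℚ r) → Fin n → Fin r → ℚ
rowsMatrix a i j = lookup (a i) j

IsPTE : ∀ {n r} → ℕ → (Fin n → Vec ℚ r) → (Fin n → Vec ℚ r) → Set
IsPTE {n} {r} m a b =
  (∀ i j → a i ≢ b j) ×
  ((e : Vec ℕ r) → 1 ≤ ∣ e ∣ₑ → ∣ e ∣ₑ ≤ m →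
     Σℚ n (λ i → monomial e (a i)) ≡ Σℚ n (λ i → monomial e (b i)))

IsProper : ∀ {n r} → (Fin n → Vec ℚ r) → (Fin n → Vec ℚ r) → Set
IsProper {n} {r} a b = HasRank (rowsMatrix a) r × HasRank (rowsMatrix b) r

InΩ : ∀ {r} → ℕ → Vec ℚ r → Set
InΩ {r} k x =
  (∀ j → (lookup x j ≡ 0ℚ) ⊎ (lookup x j ≡ 1ℚ)) ×
  Σℚ r (λ j → lookup x j ^ℚ 2) ≡ ℕ→ℚ k

-- Polynomials in r variables over ℚ, as finite lists of terms c·x^e

Poly : ℕ → Set
Poly r = List (ℚ × Vec ℕ r)

evalTerms : ∀ {r} → List (ℚ × Vec ℕ r) → Vec ℚ r → ℚ
evalTerms List.[] x = 0ℚ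
evalTerms ((c , e) List.∷ ps) x = c * monomial e x + evalTerms ps x

eval : ∀ {r} → Poly r → Vec ℚ r → ℚ
eval = evalTerms

DegLe : ∀ {r} → ℕ → Poly r → Set
DegLe t p = All (λ ce → ∣ proj₂ ce ∣ₑ ≤ t) p

-- polynomials q₁,…,q_d (each of degree ≤ t) whose restrictions to Ω
-- form a basis of the ℚ-vector space 𝒫_t(Ω)
IsBasisPt : ∀ {r d} → ℕ → ℕ → (Fin d → Poly r) → Set
IsBasisPt {r} {d} t k q =
  (∀ i → DegLe t (q i)) ×
  ((c : Fin d → ℚ) →
     (∀ x → InΩ k x → Σℚ d (λ i → c i * eval (q i) x) ≡ 0ℚ) →
     ∀ i → c i ≡ 0ℚ) ×
  ((p : Poly r) → DegLe t p →
     Σ (Fin d → ℚ) λ c →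
       ∀ x → InΩ k x → eval p x ≡ Σℚ d (λ i → c i * eval (q i) x))

NANB : ∀ {r d n} → (Fin d → Poly r) → (Fin n → Vec ℚ r) → (Fin n → Vec ℚ r) →
       Fin d → Fin (n ℕ.+ n) → ℚ
NANB {n = n} q a b i j =
  [ (λ l → eval (q i) (a l)) , (λ l → eval (q i) (b l)) ]′ (splitAt n j)

{-# OPTIONS --safe #-}

-- The polynomials of degree at most t restricted to the slice Ω = S_k^{r-1} span a space of
-- dimension at least C(r,t) when t ≤ k ≤ r - t.  An independent family of that size is built
-- along Pascal's rule C(r+1,t+1) = C(r,t+1) + C(r,t), by splitting Ω according to the first
-- coordinate x₀: one family ignores x₀, the other is multiplied by x₀ or by 1 - x₀.
--
-- Evaluation at the points of A is injective on this space.  If g has degree at most t and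
-- vanishes on A, the PTE identities of degree 2t give Σ g(bᵢ)² = Σ g(aᵢ)² = 0, so g vanishes on
-- B too.  Writing g = Σ c_l 𝐭_l on Ω, the vector c is then orthogonal to d independent columns
-- of [N_A N_B] in ℚ^d, hence c = 0 and g vanishes on Ω.  So C(r,t) ≤ n.

module Submission where

open import Defs
open import Data.Empty using (⊥-elim)
open import Data.Fin as Fin using (Fin; zero; suc; _↑ˡ_; _↑ʳ_; splitAt; punchIn; punchOut)
open import Data.Fin.Properties
  using (any?; punchIn-punchOut; splitAt-↑ˡ; splitAt-↑ʳ; splitAt⁻¹-↑ˡ; splitAt⁻¹-↑ʳ)
import Data.Integer as ℤ
import Data.Integer.Properties as ℤ
open import Data.List using ([]; _∷_; _++_)
open import Data.List.Relation.Unary.All as All using (All; []; _∷_)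
import Data.List.Relation.Unary.All.Properties as All
open import Data.Nat as ℕ using (ℕ; zero; suc; _≤_; _∸_; _*_; z≤n; s≤s)
import Data.Nat.Properties as ℕ
open import Algebra.Properties.CommutativeSemigroup ℕ.+-commutativeSemigroup
  using () renaming (interchange to ℕ-+-interchange)
open import Data.Nat.Combinatorics using (_C_; nCk+nC[k+1]≡[n+1]C[k+1])
open import Data.Nat.Coprimality using (Coprime; 1-coprimeTo) renaming (sym to coprime-sym)
open import Data.Product using (Σ; _×_; _,_; proj₁; proj₂)
-- ℚ multiplication is written _·_ so that _*_ remains the ℕ multiplication of the statement.
open import Data.Rational as ℚ
  using (ℚ; 0ℚ; 1ℚ; _+_; _-_; -_; 1/_; _/_; mkℚ; NonZero; ≢-nonZero; nonNegative; nonPositive)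
  renaming (_*_ to _·_)
import Data.Rational.Properties as ℚ
open import Data.Rational.Solver using (module +-*-Solver)
open import Data.Sum using (_⊎_; inj₁; inj₂; [_,_]′)
open import Data.Vec using (Vec; []; _∷_; lookup; zipWith; replicate)
open import Data.Vec.Properties using (lookup-zipWith)
import Data.Vec.Functional as Vector
open import Function using (_∘_; id)
open import Relation.Binary.PropositionalEquality
open import Relation.Nullary using (¬_; yes; no; ¬?)
open import Relation.Nullary.Decidable using (decidable-stable)

open +-*-Solver using (solve; _:+_; _:*_; :-_; con; _:=_)

Σℚ-cong : ∀ m {f g : Fin m → ℚ} → (∀ i → f i ≡ g i) → Σℚ m f ≡ Σℚ m g
Σℚ-cong zero    f≗g = refl
Σℚ-cong (suc m) f≗g = cong₂ _+_ (f≗g zero) (Σℚ-cong m (f≗g ∘ suc))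

Σℚ-zero : ∀ m {f : Fin m → ℚ} → (∀ i → f i ≡ 0ℚ) → Σℚ m f ≡ 0ℚ
Σℚ-zero zero    f≗0 = refl
Σℚ-zero (suc m) f≗0 = cong₂ _+_ (f≗0 zero) (Σℚ-zero m (f≗0 ∘ suc))

Σℚ-distrib-+ : ∀ m (f g : Fin m → ℚ) → Σℚ m (λ i → f i + g i) ≡ Σℚ m f + Σℚ m g
Σℚ-distrib-+ zero    f g = refl
Σℚ-distrib-+ (suc m) f g =
  trans (cong (f zero + g zero +_) (Σℚ-distrib-+ m (f ∘ suc) (g ∘ suc)))
        (solve 4 (λ a b c d → (a :+ b) :+ (c :+ d) := (a :+ c) :+ (b :+ d)) refl
               (f zero) (g zero) (Σℚ m (f ∘ suc)) (Σℚ m (g ∘ suc)))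

*-distribˡ-Σℚ : ∀ m c (f : Fin m → ℚ) → c · Σℚ m f ≡ Σℚ m (λ i → c · f i)
*-distribˡ-Σℚ zero    c f = ℚ.*-zeroʳ c
*-distribˡ-Σℚ (suc m) c f =
  trans (ℚ.*-distribˡ-+ c (f zero) _) (cong (c · f zero +_) (*-distribˡ-Σℚ m c (f ∘ suc)))

Σℚ-affine : ∀ m c (f g : Fin m → ℚ) → Σℚ m (λ i → c · f i + g i) ≡ c · Σℚ m f + Σℚ m g
Σℚ-affine m c f g =
  trans (Σℚ-distrib-+ m (λ i → c · f i) g) (cong (_+ Σℚ m g) (sym (*-distribˡ-Σℚ m c f)))

Σℚ-comm : ∀ m p (f : Fin m → Fin p → ℚ) →
          Σℚ m (λ i → Σℚ p (f i)) ≡ Σℚ p (λ j → Σℚ m (λ i → f i j))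
Σℚ-comm zero    p f = sym (Σℚ-zero p (λ _ → refl))
Σℚ-comm (suc m) p f =
  trans (cong (Σℚ p (f zero) +_) (Σℚ-comm m p (f ∘ suc))) (sym (Σℚ-distrib-+ p (f zero) _))

Σℚ-++ : ∀ m n (f : Fin (m ℕ.+ n) → ℚ) →
        Σℚ (m ℕ.+ n) f ≡ Σℚ m (λ i → f (i ↑ˡ n)) + Σℚ n (λ j → f (m ↑ʳ j))
Σℚ-++ zero    n f = sym (ℚ.+-identityˡ _)
Σℚ-++ (suc m) n f = trans (cong (f zero +_) (Σℚ-++ m n (f ∘ suc))) (sym (ℚ.+-assoc (f zero) _ _))

Σℕ-cong : ∀ m {f g : Fin m → ℕ} → (∀ i → f i ≡ g i) → Σℕ m f ≡ Σℕ m g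
Σℕ-cong zero    f≗g = refl
Σℕ-cong (suc m) f≗g = cong₂ ℕ._+_ (f≗g zero) (Σℕ-cong m (f≗g ∘ suc))

Σℕ-distrib-+ : ∀ m (f g : Fin m → ℕ) → Σℕ m (λ i → f i ℕ.+ g i) ≡ Σℕ m f ℕ.+ Σℕ m g
Σℕ-distrib-+ zero    f g = refl
Σℕ-distrib-+ (suc m) f g =
  trans (cong (f zero ℕ.+ g zero ℕ.+_) (Σℕ-distrib-+ m (f ∘ suc) (g ∘ suc)))
        (ℕ-+-interchange (f zero) (g zero) _ _)

Σℕ≡0⇒≡0 : ∀ m (f : Fin m → ℕ) → Σℕ m f ≡ 0 → ∀ i → f i ≡ 0
Σℕ≡0⇒≡0 (suc m) f Σ≡0 zero    = ℕ.m+n≡0⇒m≡0 (f zero) Σ≡0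
Σℕ≡0⇒≡0 (suc m) f Σ≡0 (suc i) = Σℕ≡0⇒≡0 m (f ∘ suc) (ℕ.m+n≡0⇒n≡0 (f zero) Σ≡0) i

Πℚ-cong : ∀ m {f g : Fin m → ℚ} → (∀ i → f i ≡ g i) → Πℚ m f ≡ Πℚ m g
Πℚ-cong zero    f≗g = refl
Πℚ-cong (suc m) f≗g = cong₂ _·_ (f≗g zero) (Πℚ-cong m (f≗g ∘ suc))

Πℚ-one : ∀ m {f : Fin m → ℚ} → (∀ i → f i ≡ 1ℚ) → Πℚ m f ≡ 1ℚ
Πℚ-one zero    f≗1 = refl
Πℚ-one (suc m) f≗1 = cong₂ _·_ (f≗1 zero) (Πℚ-one m (f≗1 ∘ suc))

Πℚ-distrib-· : ∀ m (f g : Fin m → ℚ) → Πℚ m (λ i → f i · g i) ≡ Πℚ m f · Πℚ m g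
Πℚ-distrib-· zero    f g = refl
Πℚ-distrib-· (suc m) f g =
  trans (cong (f zero · g zero ·_) (Πℚ-distrib-· m (f ∘ suc) (g ∘ suc)))
        (solve 4 (λ a b c d → (a :* b) :* (c :* d) := (a :* c) :* (b :* d)) refl
               (f zero) (g zero) (Πℚ m (f ∘ suc)) (Πℚ m (g ∘ suc)))

^ℚ-distribˡ-+-· : ∀ x m n → x ^ℚ (m ℕ.+ n) ≡ x ^ℚ m · x ^ℚ n
^ℚ-distribˡ-+-· x zero    n = sym (ℚ.*-identityˡ _)
^ℚ-distribˡ-+-· x (suc m) n = trans (cong (x ·_) (^ℚ-distribˡ-+-· x m n)) (sym (ℚ.*-assoc x _ _))

p≡0⇒p·q≡0 : ∀ {p} q → p ≡ 0ℚ → p · q ≡ 0ℚ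
p≡0⇒p·q≡0 q refl = ℚ.*-zeroˡ q

q≡0⇒p·q≡0 : ∀ p {q} → q ≡ 0ℚ → p · q ≡ 0ℚ
q≡0⇒p·q≡0 p refl = ℚ.*-zeroʳ p

p·q≡0∧q≢0⇒p≡0 : ∀ {p q} → p · q ≡ 0ℚ → q ≢ 0ℚ → p ≡ 0ℚ
p·q≡0∧q≢0⇒p≡0 {p} {q} pq≡0 q≢0 = begin
  p                ≡⟨ sym (ℚ.*-identityʳ p) ⟩
  p · 1ℚ           ≡⟨ cong (p ·_) (sym (ℚ.*-inverseʳ q)) ⟩
  p · (q · 1/ q)   ≡⟨ sym (ℚ.*-assoc p q (1/ q)) ⟩
  (p · q) · 1/ q   ≡⟨ cong (_· 1/ q) pq≡0 ⟩
  0ℚ · 1/ q        ≡⟨ ℚ.*-zeroˡ (1/ q) ⟩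
  0ℚ               ∎
  where
  open ≡-Reasoning
  instance
    q-nonZero : NonZero q
    q-nonZero = ≢-nonZero q≢0

p·p≡0⇒p≡0 : ∀ p → p · p ≡ 0ℚ → p ≡ 0ℚ
p·p≡0⇒p≡0 p pp≡0 = decidable-stable (p ℚ.≟ 0ℚ) (λ p≢0 → p≢0 (p·q≡0∧q≢0⇒p≡0 pp≡0 p≢0))

0≤p·p : ∀ p → 0ℚ ℚ.≤ p · p
0≤p·p p with ℚ.≤-total 0ℚ p
... | inj₁ 0≤p = let instance _ = nonNegative 0≤p in ℚ.nonNegative⁻¹ _ {{ℚ.nonNeg*nonNeg⇒nonNeg p p}}
... | inj₂ p≤0 = let instance _ = nonPositive p≤0 in ℚ.nonNegative⁻¹ _ {{ℚ.nonPos*nonPos⇒nonPos p p}}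

nonNeg+nonNeg≡0⇒≡0 : ∀ {p q} → 0ℚ ℚ.≤ p → 0ℚ ℚ.≤ q → p + q ≡ 0ℚ → p ≡ 0ℚ × q ≡ 0ℚ
nonNeg+nonNeg≡0⇒≡0 {p} {q} 0≤p 0≤q p+q≡0 = ℚ.≤-antisym p≤0 0≤p , ℚ.≤-antisym q≤0 0≤q
  where
  open ℚ.≤-Reasoning
  p≤0 : p ℚ.≤ 0ℚ
  p≤0 = begin
    p       ≡⟨ ℚ.+-identityʳ p ⟨
    p + 0ℚ  ≤⟨ ℚ.+-monoʳ-≤ p 0≤q ⟩
    p + q   ≡⟨ p+q≡0 ⟩
    0ℚ      ∎
  q≤0 : q ℚ.≤ 0ℚ
  q≤0 = begin
    q       ≡⟨ ℚ.+-identityˡ q ⟨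
    0ℚ + q  ≤⟨ ℚ.+-monoˡ-≤ q 0≤p ⟩
    p + q   ≡⟨ p+q≡0 ⟩
    0ℚ      ∎

Σℚ-squares-nonNeg : ∀ m (f : Fin m → ℚ) → 0ℚ ℚ.≤ Σℚ m (λ i → f i · f i)
Σℚ-squares-nonNeg zero    f = ℚ.≤-refl
Σℚ-squares-nonNeg (suc m) f = ℚ.+-mono-≤ (0≤p·p (f zero)) (Σℚ-squares-nonNeg m (f ∘ suc))

Σℚ-squares≡0⇒≡0 : ∀ m (f : Fin m → ℚ) → Σℚ m (λ i → f i · f i) ≡ 0ℚ → ∀ i → f i ≡ 0ℚ
Σℚ-squares≡0⇒≡0 (suc m) f Σ≡0 = f≡0
  where
  both≡0 : f zero · f zero ≡ 0ℚ × Σℚ m (λ i → f (suc i) · f (suc i)) ≡ 0ℚ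
  both≡0 = nonNeg+nonNeg≡0⇒≡0 (0≤p·p (f zero)) (Σℚ-squares-nonNeg m (f ∘ suc)) Σ≡0
  f≡0 : ∀ i → f i ≡ 0ℚ
  f≡0 zero    = p·p≡0⇒p≡0 (f zero) (proj₁ both≡0)
  f≡0 (suc i) = Σℚ-squares≡0⇒≡0 m (f ∘ suc) (proj₂ both≡0) i

zero-row⇒¬LinIndep : ∀ {m p} (v : Fin (suc m) → Fin p → ℚ) → (∀ j → v zero j ≡ 0ℚ) → ¬ LinIndep v
zero-row⇒¬LinIndep {m} v row₀≡0 v-indep = 1≢0 (v-indep e₀ e₀·v≡0 zero)
  where
  1≢0 : 1ℚ ≢ 0ℚ
  1≢0 ()
  e₀ : Fin (suc m) → ℚ
  e₀ zero    = 1ℚ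
  e₀ (suc _) = 0ℚ
  e₀·v≡0 : ∀ j → Σℚ (suc m) (λ i → e₀ i · v i j) ≡ 0ℚ
  e₀·v≡0 j = cong₂ _+_ (cong (1ℚ ·_) (row₀≡0 j))
                       (Σℚ-zero m (λ i → ℚ.*-zeroˡ (v (suc i) j)))

module Elimination {m p : ℕ} (v : Fin (suc m) → Fin (suc p) → ℚ) (j₀ : Fin (suc p))
                   (pivot≢0 : v zero j₀ ≢ 0ℚ) where

  private instance
    pivot-nonZero : NonZero (v zero j₀)
    pivot-nonZero = ≢-nonZero pivot≢0

  multiplier : Fin m → ℚ
  multiplier i = v (suc i) j₀ · 1/ v zero j₀

  reduced : Fin m → Fin (suc p) → ℚ
  reduced i j = v (suc i) j - multiplier i · v zero j

  reduced-pivot≡0 : ∀ i → reduced i j₀ ≡ 0ℚ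
  reduced-pivot≡0 i = begin
    x - (x · 1/ y) · y    ≡⟨ cong (λ z → x - z) (ℚ.*-assoc x (1/ y) y) ⟩
    x - x · (1/ y · y)    ≡⟨ cong (λ z → x - x · z) (ℚ.*-inverseˡ y) ⟩
    x - x · 1ℚ            ≡⟨ cong (λ z → x - z) (ℚ.*-identityʳ x) ⟩
    x - x                 ≡⟨ ℚ.+-inverseʳ x ⟩
    0ℚ                    ∎
    where
    open ≡-Reasoning
    x y : ℚ
    x = v (suc i) j₀
    y = v zero j₀

  eliminated : Fin m → Fin p → ℚ
  eliminated i j = reduced i (punchIn j₀ j)

  liftCoefficients : (Fin m → ℚ) → Fin (suc m) → ℚ
  liftCoefficients c zero    = - Σℚ m (λ i → c i · multiplier i)
  liftCoefficients c (suc i) = c i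

  reduced-combination : ∀ c j → Σℚ (suc m) (λ i → liftCoefficients c i · v i j)
                                ≡ Σℚ m (λ i → c i · reduced i j)
  reduced-combination c j = sym (begin
    Σℚ m (λ i → c i · reduced i j)
      ≡⟨ Σℚ-cong m (λ i → solve 4 (λ c x μ y → c :* (x :+ (:- (μ :* y))) := c :* x :+ (:- y) :* (c :* μ))
                                   refl (c i) (v (suc i) j) (multiplier i) (v zero j)) ⟩
    Σℚ m (λ i → c i · v (suc i) j + - v zero j · (c i · multiplier i))
      ≡⟨ Σℚ-distrib-+ m _ _ ⟩
    Σℚ m (λ i → c i · v (suc i) j) + Σℚ m (λ i → - v zero j · (c i · multiplier i))
      ≡⟨ cong (Σℚ m (λ i → c i · v (suc i) j) +_) (sym (*-distribˡ-Σℚ m (- v zero j) _)) ⟩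
    Σℚ m (λ i → c i · v (suc i) j) + - v zero j · S
      ≡⟨ solve 3 (λ a y s → a :+ (:- y) :* s := (:- s) :* y :+ a) refl _ (v zero j) S ⟩
    - S · v zero j + Σℚ m (λ i → c i · v (suc i) j)
      ∎)
    where
    open ≡-Reasoning
    S : ℚ
    S = Σℚ m (λ i → c i · multiplier i)

  eliminated-indep : LinIndep v → LinIndep eliminated
  eliminated-indep v-indep c c·eliminated≡0 i = v-indep (liftCoefficients c) combination≡0 (suc i)
    where
    c·reduced≡0 : ∀ j → Σℚ m (λ i → c i · reduced i j) ≡ 0ℚ
    c·reduced≡0 j with j₀ Fin.≟ j
    ... | yes refl = Σℚ-zero m (λ i → q≡0⇒p·q≡0 (c i) (reduced-pivot≡0 i))
    ... | no  j₀≢j =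
      trans (Σℚ-cong m (λ i → cong (λ l → c i · reduced i l) (sym (punchIn-punchOut j₀≢j))))
            (c·eliminated≡0 (punchOut j₀≢j))
    combination≡0 : ∀ j → Σℚ (suc m) (λ i → liftCoefficients c i · v i j) ≡ 0ℚ
    combination≡0 j = trans (reduced-combination c j) (c·reduced≡0 j)

LinIndep⇒≤ : ∀ {m p} (v : Fin m → Fin p → ℚ) → LinIndep v → m ≤ p
LinIndep⇒≤ {zero}          v v-indep = z≤n
LinIndep⇒≤ {suc m} {zero}  v v-indep = ⊥-elim (zero-row⇒¬LinIndep v (λ ()) v-indep)
LinIndep⇒≤ {suc m} {suc p} v v-indep with any? (λ j → ¬? (v zero j ℚ.≟ 0ℚ))
... | yes (j₀ , pivot≢0) = s≤s (LinIndep⇒≤ eliminated (eliminated-indep v-indep))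
  where open Elimination v j₀ pivot≢0
... | no  no-pivot = ⊥-elim (zero-row⇒¬LinIndep v row₀≡0 v-indep)
  where
  row₀≡0 : ∀ j → v zero j ≡ 0ℚ
  row₀≡0 j = decidable-stable (v zero j ℚ.≟ 0ℚ) (λ v≢0 → no-pivot (j , v≢0))

orthogonal-to-combination : ∀ {m d} (v : Fin m → Fin d → ℚ) (c : Fin d → ℚ) →
  (∀ l → Σℚ d (λ j → c j · v l j) ≡ 0ℚ) →
  (μ : Fin m → ℚ) → Σℚ d (λ j → c j · Σℚ m (λ l → μ l · v l j)) ≡ 0ℚ
orthogonal-to-combination {m} {d} v c c⊥v μ = begin
  Σℚ d (λ j → c j · Σℚ m (λ l → μ l · v l j))
    ≡⟨ Σℚ-cong d (λ j → trans (*-distribˡ-Σℚ m (c j) _) (Σℚ-cong m (λ l → swap (c j) (μ l) (v l j)))) ⟩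
  Σℚ d (λ j → Σℚ m (λ l → μ l · (c j · v l j)))
    ≡⟨ Σℚ-comm d m _ ⟩
  Σℚ m (λ l → Σℚ d (λ j → μ l · (c j · v l j)))
    ≡⟨ Σℚ-zero m (λ l → trans (sym (*-distribˡ-Σℚ d (μ l) _)) (q≡0⇒p·q≡0 (μ l) (c⊥v l))) ⟩
  0ℚ ∎
  where
  open ≡-Reasoning
  swap : ∀ x y z → x · (y · z) ≡ y · (x · z)
  swap = solve 3 (λ x y z → x :* (y :* z) := y :* (x :* z)) refl

LinIndep-∷-orthogonal : ∀ {m d} (v : Fin m → Fin d → ℚ) → LinIndep v →
  (c : Fin d → ℚ) → Σℚ d (λ j → c j · c j) ≢ 0ℚ → (∀ l → Σℚ d (λ j → c j · v l j) ≡ 0ℚ) →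
  LinIndep (c Vector.∷ v)
LinIndep-∷-orthogonal {m} {d} v v-indep c c·c≢0 c⊥v μ μ·[c∷v]≡0 = μ≡0
  where
  open ≡-Reasoning
  T : Fin d → ℚ
  T j = Σℚ m (λ l → μ (suc l) · v l j)
  μ₀c·c≡0 : μ zero · Σℚ d (λ j → c j · c j) ≡ 0ℚ
  μ₀c·c≡0 = begin
    μ zero · Σℚ d (λ j → c j · c j)
      ≡⟨ ℚ.+-identityʳ _ ⟨
    μ zero · Σℚ d (λ j → c j · c j) + 0ℚ
      ≡⟨ cong (μ zero · Σℚ d (λ j → c j · c j) +_) (orthogonal-to-combination v c c⊥v (μ ∘ suc)) ⟨
    μ zero · Σℚ d (λ j → c j · c j) + Σℚ d (λ j → c j · T j)
      ≡⟨ Σℚ-affine d (μ zero) _ _ ⟨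
    Σℚ d (λ j → μ zero · (c j · c j) + c j · T j)
      ≡⟨ Σℚ-cong d (λ j → expand (μ zero) (c j) (T j)) ⟩
    Σℚ d (λ j → c j · (μ zero · c j + T j))
      ≡⟨ Σℚ-zero d (λ j → q≡0⇒p·q≡0 (c j) (μ·[c∷v]≡0 j)) ⟩
    0ℚ ∎
    where
    expand : ∀ μ₀ x t → μ₀ · (x · x) + x · t ≡ x · (μ₀ · x + t)
    expand = solve 3 (λ μ₀ x t → μ₀ :* (x :* x) :+ x :* t := x :* (μ₀ :* x :+ t)) refl
  μ₀≡0 : μ zero ≡ 0ℚ
  μ₀≡0 = p·q≡0∧q≢0⇒p≡0 μ₀c·c≡0 c·c≢0
  μ≡0 : ∀ i → μ i ≡ 0ℚ
  μ≡0 zero    = μ₀≡0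
  μ≡0 (suc l) = v-indep (μ ∘ suc) (λ j → begin
    T j                   ≡⟨ ℚ.+-identityˡ (T j) ⟨
    0ℚ + T j              ≡⟨ cong (_+ T j) (p≡0⇒p·q≡0 (c j) μ₀≡0) ⟨
    μ zero · c j + T j    ≡⟨ μ·[c∷v]≡0 j ⟩
    0ℚ                    ∎) l

orthogonal⇒≡0 : ∀ {d} (v : Fin d → Fin d → ℚ) → LinIndep v →
  (c : Fin d → ℚ) → (∀ l → Σℚ d (λ j → c j · v l j) ≡ 0ℚ) → ∀ j → c j ≡ 0ℚ
orthogonal⇒≡0 {d} v v-indep c c⊥v = Σℚ-squares≡0⇒≡0 d c c·c≡0
  where
  c·c≡0 : Σℚ d (λ j → c j · c j) ≡ 0ℚ
  c·c≡0 = decidable-stable (_ ℚ.≟ 0ℚ) (λ c·c≢0 →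
    ℕ.1+n≰n (LinIndep⇒≤ (c Vector.∷ v) (LinIndep-∷-orthogonal v v-indep c c·c≢0 c⊥v)))

∣zipWith-+∣ₑ : ∀ {r} (e e' : Vec ℕ r) → ∣ zipWith ℕ._+_ e e' ∣ₑ ≡ ∣ e ∣ₑ ℕ.+ ∣ e' ∣ₑ
∣zipWith-+∣ₑ {r} e e' =
  trans (Σℕ-cong r (λ j → lookup-zipWith ℕ._+_ j e e')) (Σℕ-distrib-+ r (lookup e) (lookup e'))

∣replicate-0∣ₑ : ∀ r → ∣ replicate r 0 ∣ₑ ≡ 0
∣replicate-0∣ₑ zero    = refl
∣replicate-0∣ₑ (suc r) = ∣replicate-0∣ₑ r

monomial-zipWith-+ : ∀ {r} (e e' : Vec ℕ r) x →
                     monomial (zipWith ℕ._+_ e e') x ≡ monomial e x · monomial e' x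
monomial-zipWith-+ {r} e e' x = trans (Πℚ-cong r exponent-+) (Πℚ-distrib-· r _ _)
  where
  exponent-+ : ∀ j → lookup x j ^ℚ lookup (zipWith ℕ._+_ e e') j
                     ≡ lookup x j ^ℚ lookup e j · lookup x j ^ℚ lookup e' j
  exponent-+ j = trans (cong (lookup x j ^ℚ_) (lookup-zipWith ℕ._+_ j e e'))
                       (^ℚ-distribˡ-+-· (lookup x j) (lookup e j) (lookup e' j))

monomial-degree-0 : ∀ {r} (e : Vec ℕ r) x → ∣ e ∣ₑ ≡ 0 → monomial e x ≡ 1ℚ
monomial-degree-0 {r} e x ∣e∣≡0 =
  Πℚ-one r (λ j → cong (lookup x j ^ℚ_) (Σℕ≡0⇒≡0 r (lookup e) ∣e∣≡0 j))

DegLe-weaken : ∀ {r s t} → s ≤ t → (p : Poly r) → DegLe s p → DegLe t p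
DegLe-weaken s≤t p = All.map (λ deg≤s → ℕ.≤-trans deg≤s s≤t)

one : ∀ {r} → Poly r
one {r} = (1ℚ , replicate r 0) ∷ []

eval-one : ∀ {r} (x : Vec ℚ r) → eval one x ≡ 1ℚ
eval-one {r} x = trans (ℚ.+-identityʳ _)
                       (trans (ℚ.*-identityˡ _) (monomial-degree-0 (replicate r 0) x (∣replicate-0∣ₑ r)))

DegLe-one : ∀ {r t} → DegLe t (one {r})
DegLe-one {r} = subst (_≤ _) (sym (∣replicate-0∣ₑ r)) z≤n ∷ []

scale : ∀ {r} → ℚ → Poly r → Poly r
scale c []             = []
scale c ((c' , e) ∷ p) = (c · c' , e) ∷ scale c p

eval-scale : ∀ {r} c (p : Poly r) x → eval (scale c p) x ≡ c · eval p x
eval-scale c []             x = sym (ℚ.*-zeroʳ c)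
eval-scale c ((c' , e) ∷ p) x =
  trans (cong ((c · c') · monomial e x +_) (eval-scale c p x))
        (solve 4 (λ c c' m q → (c :* c') :* m :+ c :* q := c :* (c' :* m :+ q)) refl
               c c' (monomial e x) (eval p x))

DegLe-scale : ∀ {r t} c (p : Poly r) → DegLe t p → DegLe t (scale c p)
DegLe-scale c []      []             = []
DegLe-scale c (_ ∷ p) (deg≤ ∷ p-deg) = deg≤ ∷ DegLe-scale c p p-deg

eval-++ : ∀ {r} (p p' : Poly r) x → eval (p ++ p') x ≡ eval p x + eval p' x
eval-++ []             p' x = sym (ℚ.+-identityˡ _)
eval-++ ((c , e) ∷ p) p' x =
  trans (cong (c · monomial e x +_) (eval-++ p p' x)) (sym (ℚ.+-assoc (c · monomial e x) _ _))

linearCombination : ∀ {r} N → (Fin N → ℚ) → (Fin N → Poly r) → Poly r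
linearCombination zero    γ f = []
linearCombination (suc N) γ f = scale (γ zero) (f zero) ++ linearCombination N (γ ∘ suc) (f ∘ suc)

eval-linearCombination : ∀ {r} N γ (f : Fin N → Poly r) x →
                         eval (linearCombination N γ f) x ≡ Σℚ N (λ j → γ j · eval (f j) x)
eval-linearCombination zero    γ f x = refl
eval-linearCombination (suc N) γ f x =
  trans (eval-++ (scale (γ zero) (f zero)) _ x)
        (cong₂ _+_ (eval-scale (γ zero) (f zero) x) (eval-linearCombination N (γ ∘ suc) (f ∘ suc) x))

DegLe-linearCombination : ∀ {r t} N γ (f : Fin N → Poly r) → (∀ j → DegLe t (f j)) →
                          DegLe t (linearCombination N γ f)
DegLe-linearCombination zero    γ f f-deg = []
DegLe-linearCombination (suc N) γ f f-deg =
  All.++⁺ (DegLe-scale (γ zero) (f zero) (f-deg zero))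
          (DegLe-linearCombination N (γ ∘ suc) (f ∘ suc) (f-deg ∘ suc))

lift : ∀ {r} → Poly r → Poly (suc r)
lift []            = []
lift ((c , e) ∷ p) = (c , 0 ∷ e) ∷ lift p

mulX₀ : ∀ {r} → Poly r → Poly (suc r)
mulX₀ []            = []
mulX₀ ((c , e) ∷ p) = (c , 1 ∷ e) ∷ mulX₀ p

mulOneMinusX₀ : ∀ {r} → Poly r → Poly (suc r)
mulOneMinusX₀ p = lift p ++ scale (- 1ℚ) (mulX₀ p)

eval-lift : ∀ {r} (p : Poly r) x₀ x → eval (lift p) (x₀ ∷ x) ≡ eval p x
eval-lift []            x₀ x = refl
eval-lift ((c , e) ∷ p) x₀ x =
  cong₂ (λ m q → c · m + q) (ℚ.*-identityˡ (monomial e x)) (eval-lift p x₀ x)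

eval-mulX₀ : ∀ {r} (p : Poly r) x₀ x → eval (mulX₀ p) (x₀ ∷ x) ≡ x₀ · eval p x
eval-mulX₀ []            x₀ x = sym (ℚ.*-zeroʳ x₀)
eval-mulX₀ ((c , e) ∷ p) x₀ x =
  trans (cong₂ (λ m q → c · (m · monomial e x) + q) (ℚ.*-identityʳ x₀) (eval-mulX₀ p x₀ x))
        (solve 4 (λ c x₀ m q → c :* (x₀ :* m) :+ x₀ :* q := x₀ :* (c :* m :+ q)) refl
               c x₀ (monomial e x) (eval p x))

eval-mulOneMinusX₀ : ∀ {r} (p : Poly r) x₀ x → eval (mulOneMinusX₀ p) (x₀ ∷ x) ≡ (1ℚ - x₀) · eval p x
eval-mulOneMinusX₀ p x₀ x = begin
  eval (lift p ++ scale (- 1ℚ) (mulX₀ p)) (x₀ ∷ x)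
    ≡⟨ eval-++ (lift p) _ (x₀ ∷ x) ⟩
  eval (lift p) (x₀ ∷ x) + eval (scale (- 1ℚ) (mulX₀ p)) (x₀ ∷ x)
    ≡⟨ cong₂ _+_ (eval-lift p x₀ x) (eval-scale (- 1ℚ) (mulX₀ p) (x₀ ∷ x)) ⟩
  eval p x + - 1ℚ · eval (mulX₀ p) (x₀ ∷ x)
    ≡⟨ cong (λ q → eval p x + - 1ℚ · q) (eval-mulX₀ p x₀ x) ⟩
  eval p x + - 1ℚ · (x₀ · eval p x)
    ≡⟨ solve 2 (λ x₀ q → q :+ (:- con 1ℚ) :* (x₀ :* q) := (con 1ℚ :+ (:- x₀)) :* q) refl x₀ (eval p x) ⟩
  (1ℚ - x₀) · eval p x ∎
  where open ≡-Reasoning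

DegLe-lift : ∀ {r t} (p : Poly r) → DegLe t p → DegLe t (lift p)
DegLe-lift []      []             = []
DegLe-lift (_ ∷ p) (deg≤ ∷ p-deg) = deg≤ ∷ DegLe-lift p p-deg

DegLe-mulX₀ : ∀ {r t} (p : Poly r) → DegLe t p → DegLe (suc t) (mulX₀ p)
DegLe-mulX₀ []      []             = []
DegLe-mulX₀ (_ ∷ p) (deg≤ ∷ p-deg) = s≤s deg≤ ∷ DegLe-mulX₀ p p-deg

DegLe-mulOneMinusX₀ : ∀ {r t} (p : Poly r) → DegLe t p → DegLe (suc t) (mulOneMinusX₀ p)
DegLe-mulOneMinusX₀ p p-deg =
  All.++⁺ (DegLe-lift p (DegLe-weaken (ℕ.n≤1+n _) p p-deg))
          (DegLe-scale (- 1ℚ) (mulX₀ p) (DegLe-mulX₀ p p-deg))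

EqualSums : ∀ {n r} → (Fin n → Vec ℚ r) → (Fin n → Vec ℚ r) → (Vec ℚ r → ℚ) → Set
EqualSums {n} a b f = Σℚ n (λ i → f (a i)) ≡ Σℚ n (λ i → f (b i))

module _ {n r : ℕ} (a b : Fin n → Vec ℚ r) where

  EqualSums-cong : ∀ f g → (∀ x → f x ≡ g x) → EqualSums a b f → EqualSums a b g
  EqualSums-cong f g f≗g f-equal =
    trans (sym (Σℚ-cong n (f≗g ∘ a))) (trans f-equal (Σℚ-cong n (f≗g ∘ b)))

  EqualSums-affine : ∀ c f g → EqualSums a b f → EqualSums a b g →
                     EqualSums a b (λ x → c · f x + g x)
  EqualSums-affine c f g f-equal g-equal =
    trans (Σℚ-affine n c (f ∘ a) (g ∘ a))
          (trans (cong₂ (λ u w → c · u + w) f-equal g-equal) (sym (Σℚ-affine n c (f ∘ b) (g ∘ b))))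

  EqualSums-eval· : ∀ (p : Poly r) (g : Vec ℚ r → ℚ) →
    All (λ ce → EqualSums a b (λ x → monomial (proj₂ ce) x · g x)) p →
    EqualSums a b (λ x → eval p x · g x)
  EqualSums-eval· []            g []                    =
    EqualSums-cong (λ _ → 0ℚ) (λ x → 0ℚ · g x) (λ x → sym (ℚ.*-zeroˡ (g x))) refl
  EqualSums-eval· ((c , e) ∷ p) g (term-equal ∷ p-equal) =
    EqualSums-cong _ (λ x → eval ((c , e) ∷ p) x · g x)
                   (λ x → distrib c (monomial e x) (eval p x) (g x))
                   (EqualSums-affine c (λ x → monomial e x · g x) (λ x → eval p x · g x)
                                     term-equal (EqualSums-eval· p g p-equal))
    where
    distrib : ∀ c m q y → c · (m · y) + q · y ≡ (c · m + q) · y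
    distrib = solve 4 (λ c m q y → c :* (m :* y) :+ q :* y := (c :* m :+ q) :* y) refl

module _ {n r t : ℕ} {a b : Fin n → Vec ℚ r} (pte : IsPTE (2 * t) a b) where

  EqualSums-monomial : ∀ e → ∣ e ∣ₑ ≤ 2 * t → EqualSums a b (monomial e)
  EqualSums-monomial e deg≤2t with ∣ e ∣ₑ ℕ.≟ 0
  ... | yes deg≡0 =
    EqualSums-cong a b (λ _ → 1ℚ) (monomial e) (λ x → sym (monomial-degree-0 e x deg≡0)) refl
  ... | no  deg≢0 = proj₂ pte e (ℕ.n≢0⇒n>0 deg≢0) deg≤2t

  EqualSums-product : ∀ p p' → DegLe t p → DegLe t p' →
                      EqualSums a b (λ x → eval p x · eval p' x)
  EqualSums-product p p' p-deg p'-deg =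
    EqualSums-eval· a b p (eval p') (All.map (λ {ce} → monomial·p' {ce}) p-deg)
    where
    monomial·monomial : ∀ {e} → ∣ e ∣ₑ ≤ t → ∀ {ce : ℚ × Vec ℕ r} → ∣ proj₂ ce ∣ₑ ≤ t →
                        EqualSums a b (λ x → monomial (proj₂ ce) x · monomial e x)
    monomial·monomial {e} e≤t {_ , e'} e'≤t =
      EqualSums-cong a b _ (λ x → monomial e' x · monomial e x) (monomial-zipWith-+ e' e)
                     (EqualSums-monomial (zipWith ℕ._+_ e' e) sum≤2t)
      where
      open ℕ.≤-Reasoning
      sum≤2t : ∣ zipWith ℕ._+_ e' e ∣ₑ ≤ 2 * t
      sum≤2t = begin
        ∣ zipWith ℕ._+_ e' e ∣ₑ  ≡⟨ ∣zipWith-+∣ₑ e' e ⟩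
        ∣ e' ∣ₑ ℕ.+ ∣ e ∣ₑ       ≤⟨ ℕ.+-mono-≤ e'≤t e≤t ⟩
        t ℕ.+ t                 ≡⟨ cong (t ℕ.+_) (ℕ.+-identityʳ t) ⟨
        2 * t                   ∎
    monomial·p' : ∀ {ce : ℚ × Vec ℕ r} → ∣ proj₂ ce ∣ₑ ≤ t →
                  EqualSums a b (λ x → monomial (proj₂ ce) x · eval p' x)
    monomial·p' {_ , e} e≤t =
      EqualSums-cong a b _ (λ x → monomial e x · eval p' x) (λ x → ℚ.*-comm (eval p' x) (monomial e x))
        (EqualSums-eval· a b p' (monomial e) (All.map (λ {ce} → monomial·monomial {e} e≤t {ce}) p'-deg))

  pte-vanishing : ∀ g → DegLe t g → (∀ i → eval g (a i) ≡ 0ℚ) → ∀ i → eval g (b i) ≡ 0ℚ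
  pte-vanishing g g-deg g[a]≡0 = Σℚ-squares≡0⇒≡0 n (λ i → eval g (b i)) (begin
    Σℚ n (λ i → eval g (b i) · eval g (b i))  ≡⟨ EqualSums-product g g g-deg g-deg ⟨
    Σℚ n (λ i → eval g (a i) · eval g (a i))  ≡⟨ Σℚ-zero n (λ i → p≡0⇒p·q≡0 (eval g (a i)) (g[a]≡0 i)) ⟩
    0ℚ                                        ∎)
    where open ≡-Reasoning

ℕ→ℚ-suc : ∀ k → ℕ→ℚ (suc k) ≡ 1ℚ + ℕ→ℚ k
ℕ→ℚ-suc k = begin
  ℕ→ℚ (suc k)                      ≡⟨ cong (λ i → (ℤ.+ 1 ℤ.+ i) / 1) (ℤ.*-identityʳ (ℤ.+ k)) ⟨
  (ℤ.+ 1 ℤ.+ ℤ.+ k ℤ.* ℤ.+ 1) / 1   ≡⟨⟩ -- ℚ addition unfolds on the denominators 1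
  1ℚ + mkℚ (ℤ.+ k) 0 k-coprime     ≡⟨ cong (1ℚ +_) (ℚ.normalize-coprime k-coprime) ⟨
  1ℚ + ℕ→ℚ k                       ∎
  where
  open ≡-Reasoning
  k-coprime : Coprime k 1
  k-coprime = coprime-sym (1-coprimeTo k)

∷-binary : ∀ {r} {x₀ : ℚ} {x : Vec ℚ r} → x₀ ≡ 0ℚ ⊎ x₀ ≡ 1ℚ →
           (∀ j → lookup x j ≡ 0ℚ ⊎ lookup x j ≡ 1ℚ) →
           ∀ j → lookup (x₀ ∷ x) j ≡ 0ℚ ⊎ lookup (x₀ ∷ x) j ≡ 1ℚ
∷-binary x₀∈01 x∈01 zero    = x₀∈01
∷-binary x₀∈01 x∈01 (suc j) = x∈01 j

InΩ-0∷ : ∀ {r k} (x : Vec ℚ r) → InΩ k x → InΩ k (0ℚ ∷ x)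
InΩ-0∷ x (x∈01 , Σx²≡k) = ∷-binary (inj₁ refl) x∈01 , trans (ℚ.+-identityˡ _) Σx²≡k

InΩ-1∷ : ∀ {r k} (x : Vec ℚ r) → InΩ k x → InΩ (suc k) (1ℚ ∷ x)
InΩ-1∷ {k = k} x (x∈01 , Σx²≡k) =
  ∷-binary (inj₂ refl) x∈01 , trans (cong (1ℚ +_) Σx²≡k) (sym (ℕ→ℚ-suc k))

Ω-nonEmpty : ∀ r k → k ≤ r → Σ (Vec ℚ r) (InΩ k)
Ω-nonEmpty zero    zero    _         = [] , (λ ()) , refl
Ω-nonEmpty (suc r) zero    _         =
  let x , x∈Ω = Ω-nonEmpty r zero z≤n in 0ℚ ∷ x , InΩ-0∷ {k = zero} x x∈Ω
Ω-nonEmpty (suc r) (suc k) (s≤s k≤r) =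
  let x , x∈Ω = Ω-nonEmpty r k k≤r in 1ℚ ∷ x , InΩ-1∷ {k = k} x x∈Ω

IndependentOn : ∀ {X : Set} → (X → Set) → ∀ {N} → (Fin N → X → ℚ) → Set
IndependentOn P {N} f = (γ : Fin N → ℚ) → (∀ x → P x → Σℚ N (λ j → γ j · f j x) ≡ 0ℚ) → ∀ j → γ j ≡ 0ℚ

IndependentOn-cong : ∀ {X : Set} {P : X → Set} {N} {f g : Fin N → X → ℚ} →
                     (∀ j x → f j x ≡ g j x) → IndependentOn P f → IndependentOn P g
IndependentOn-cong {N = N} f≗g f-indep γ γ·g≡0 =
  f-indep γ (λ x x∈P → trans (Σℚ-cong N (λ j → cong (γ j ·_) (f≗g j x))) (γ·g≡0 x x∈P))

↑ˡ-↑ʳ-elim : ∀ {A B} {Q : Fin (A ℕ.+ B) → Set} →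
             (∀ i → Q (i ↑ˡ B)) → (∀ i → Q (A ↑ʳ i)) → ∀ j → Q j
↑ˡ-↑ʳ-elim {A} {Q = Q} Qˡ Qʳ j with splitAt A j in eq
... | inj₁ i = subst Q (splitAt⁻¹-↑ˡ eq) (Qˡ i)
... | inj₂ i = subst Q (splitAt⁻¹-↑ʳ eq) (Qʳ i)

IndependentOn-triangular :
  ∀ {X Y₀ Y₁ : Set} {P : X → Set} {P₀ : Y₀ → Set} {P₁ : Y₁ → Set} {A B}
  (h : Fin (A ℕ.+ B) → X → ℚ) (ι₀ : Y₀ → X) (ι₁ : Y₁ → X) →
  (∀ y → P₀ y → P (ι₀ y)) → (∀ y → P₁ y → P (ι₁ y)) →
  (∀ i y → h (A ↑ʳ i) (ι₀ y) ≡ 0ℚ) →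
  IndependentOn P₀ (λ i → h (i ↑ˡ B) ∘ ι₀) →
  IndependentOn P₁ (λ i → h (A ↑ʳ i) ∘ ι₁) →
  IndependentOn P h
IndependentOn-triangular {X} {P = P} {A = A} {B} h ι₀ ι₁ ι₀∈P ι₁∈P hʳ∘ι₀≡0 indep₀ indep₁ γ γ·h≡0 =
  ↑ˡ-↑ʳ-elim γˡ≡0 γʳ≡0
  where
  open ≡-Reasoning
  Σˡ Σʳ : X → ℚ
  Σˡ x = Σℚ A (λ i → γ (i ↑ˡ B) · h (i ↑ˡ B) x)
  Σʳ x = Σℚ B (λ i → γ (A ↑ʳ i) · h (A ↑ʳ i) x)
  Σˡ+Σʳ≡0 : ∀ x → P x → Σˡ x + Σʳ x ≡ 0ℚ
  Σˡ+Σʳ≡0 x x∈P = trans (sym (Σℚ-++ A B _)) (γ·h≡0 x x∈P)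
  γˡ≡0 : ∀ i → γ (i ↑ˡ B) ≡ 0ℚ
  γˡ≡0 = indep₀ _ (λ y y∈P₀ → begin
    Σˡ (ι₀ y)
      ≡⟨ ℚ.+-identityʳ _ ⟨
    Σˡ (ι₀ y) + 0ℚ
      ≡⟨ cong (Σˡ (ι₀ y) +_) (Σℚ-zero B (λ i → q≡0⇒p·q≡0 (γ (A ↑ʳ i)) (hʳ∘ι₀≡0 i y))) ⟨
    Σˡ (ι₀ y) + Σʳ (ι₀ y)
      ≡⟨ Σˡ+Σʳ≡0 (ι₀ y) (ι₀∈P y y∈P₀) ⟩
    0ℚ ∎)
  γʳ≡0 : ∀ i → γ (A ↑ʳ i) ≡ 0ℚ
  γʳ≡0 = indep₁ _ (λ y y∈P₁ → begin
    Σʳ (ι₁ y)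
      ≡⟨ ℚ.+-identityˡ _ ⟨
    0ℚ + Σʳ (ι₁ y)
      ≡⟨ cong (_+ Σʳ (ι₁ y)) (Σℚ-zero A (λ i → p≡0⇒p·q≡0 (h (i ↑ˡ B) (ι₁ y)) (γˡ≡0 i))) ⟨
    Σˡ (ι₁ y) + Σʳ (ι₁ y)
      ≡⟨ Σˡ+Σʳ≡0 (ι₁ y) (ι₁∈P y y∈P₁) ⟩
    0ℚ ∎)

-- A witness of dim 𝒫_t(Ω) ≥ C(r,t) for the slice Ω of weight k in {0,1}^r.
record IndependentFamily (r t k : ℕ) : Set where
  field
    size          : ℕ
    binomial≤size : r C t ≤ size
    poly          : Fin size → Poly r
    poly-degree   : ∀ j → DegLe t (poly j)
    independent   : IndependentOn (InΩ k) (λ j → eval (poly j))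

open IndependentFamily

constantFamily : ∀ {r k} → k ≤ r → IndependentFamily r 0 k
constantFamily {r} {k} k≤r = record
  { size          = 1
  ; binomial≤size = ℕ.≤-refl
  ; poly          = λ _ → one
  ; poly-degree   = λ _ → DegLe-one
  ; independent   = one-independent
  }
  where
  one-independent : IndependentOn (InΩ k) (λ _ → eval one)
  one-independent γ γ·one≡0 zero = begin
    γ zero                   ≡⟨ ℚ.*-identityʳ _ ⟨
    γ zero · 1ℚ              ≡⟨ cong (γ zero ·_) (eval-one x) ⟨
    γ zero · eval one x      ≡⟨ ℚ.+-identityʳ _ ⟨
    γ zero · eval one x + 0ℚ ≡⟨ γ·one≡0 x x∈Ω ⟩
    0ℚ                       ∎
    where
    open ≡-Reasoning
    x : Vec ℚ r
    x = proj₁ (Ω-nonEmpty r k k≤r)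
    x∈Ω : InΩ k x
    x∈Ω = proj₂ (Ω-nonEmpty r k k≤r)

emptyFamily : ∀ {t k} → IndependentFamily 0 (suc t) k
emptyFamily = record
  { size          = 0
  ; binomial≤size = ℕ.≤-refl
  ; poly          = λ ()
  ; poly-degree   = λ ()
  ; independent   = λ _ _ ()
  }

module _ {r t k k₀ k₁ : ℕ} (z₀ z₁ : ℚ) (φ : ℚ → ℚ) (φ[z₀]≡0 : φ z₀ ≡ 0ℚ) (φ[z₁]≡1 : φ z₁ ≡ 1ℚ)
         (mulφ : Poly r → Poly (suc r))
         (eval-mulφ : ∀ (p : Poly r) x₀ (x : Vec ℚ r) → eval (mulφ p) (x₀ ∷ x) ≡ φ x₀ · eval p x)
         (DegLe-mulφ : ∀ (p : Poly r) → DegLe t p → DegLe (suc t) (mulφ p))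
         (z₀∷Ω : ∀ (x : Vec ℚ r) → InΩ k₀ x → InΩ k (z₀ ∷ x))
         (z₁∷Ω : ∀ (x : Vec ℚ r) → InΩ k₁ x → InΩ k (z₁ ∷ x)) where

  pascalFamily : IndependentFamily r (suc t) k₀ → IndependentFamily r t k₁ →
                 IndependentFamily (suc r) (suc t) k
  pascalFamily F₀ F₁ = record
    { size          = size F₀ ℕ.+ size F₁
    ; binomial≤size = binomial≤size′
    ; poly          = poly′
    ; poly-degree   = poly-degree′
    ; independent   = IndependentOn-triangular (λ j → eval (poly′ j)) (z₀ ∷_) (z₁ ∷_) z₀∷Ω z₁∷Ω
                        poly′ʳ[z₀]≡0 independent₀ independent₁
    }
    where
    binomial≤size′ : suc r C suc t ≤ size F₀ ℕ.+ size F₁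
    binomial≤size′ = begin
      suc r C suc t          ≡⟨ nCk+nC[k+1]≡[n+1]C[k+1] r t ⟨
      r C t ℕ.+ r C suc t    ≡⟨ ℕ.+-comm (r C t) (r C suc t) ⟩
      r C suc t ℕ.+ r C t    ≤⟨ ℕ.+-mono-≤ (binomial≤size F₀) (binomial≤size F₁) ⟩
      size F₀ ℕ.+ size F₁    ∎
      where open ℕ.≤-Reasoning

    poly′ : Fin (size F₀ ℕ.+ size F₁) → Poly (suc r)
    poly′ j = [ lift ∘ poly F₀ , mulφ ∘ poly F₁ ]′ (splitAt (size F₀) j)

    poly-degree′ : ∀ j → DegLe (suc t) (poly′ j)
    poly-degree′ j with splitAt (size F₀) j
    ... | inj₁ i = DegLe-lift (poly F₀ i) (poly-degree F₀ i)
    ... | inj₂ i = DegLe-mulφ (poly F₁ i) (poly-degree F₁ i)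

    poly′ˡ : ∀ i → poly′ (i ↑ˡ size F₁) ≡ lift (poly F₀ i)
    poly′ˡ i = cong [ lift ∘ poly F₀ , mulφ ∘ poly F₁ ]′ (splitAt-↑ˡ (size F₀) i (size F₁))

    poly′ʳ : ∀ i → poly′ (size F₀ ↑ʳ i) ≡ mulφ (poly F₁ i)
    poly′ʳ i = cong [ lift ∘ poly F₀ , mulφ ∘ poly F₁ ]′ (splitAt-↑ʳ (size F₀) (size F₁) i)

    eval-poly′ʳ : ∀ i x₀ x → eval (poly′ (size F₀ ↑ʳ i)) (x₀ ∷ x) ≡ φ x₀ · eval (poly F₁ i) x
    eval-poly′ʳ i x₀ x = trans (cong (λ p → eval p (x₀ ∷ x)) (poly′ʳ i)) (eval-mulφ (poly F₁ i) x₀ x)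

    poly′ʳ[z₀]≡0 : ∀ i x → eval (poly′ (size F₀ ↑ʳ i)) (z₀ ∷ x) ≡ 0ℚ
    poly′ʳ[z₀]≡0 i x = trans (eval-poly′ʳ i z₀ x)
                             (p≡0⇒p·q≡0 (eval (poly F₁ i) x) φ[z₀]≡0)

    independent₀ : IndependentOn (InΩ k₀) (λ i → eval (poly′ (i ↑ˡ size F₁)) ∘ (z₀ ∷_))
    independent₀ = IndependentOn-cong
      (λ i x → sym (trans (cong (λ p → eval p (z₀ ∷ x)) (poly′ˡ i)) (eval-lift (poly F₀ i) z₀ x)))
      (independent F₀)

    independent₁ : IndependentOn (InΩ k₁) (λ i → eval (poly′ (size F₀ ↑ʳ i)) ∘ (z₁ ∷_))
    independent₁ = IndependentOn-cong
      (λ i x → sym (trans (eval-poly′ʳ i z₁ x)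
                          (trans (cong (_· _) φ[z₁]≡1) (ℚ.*-identityˡ (eval (poly F₁ i) x)))))
      (independent F₁)

diagonalFamily : ∀ r t → IndependentFamily r t t
diagonalFamily r       zero    = constantFamily z≤n
diagonalFamily zero    (suc t) = emptyFamily
diagonalFamily (suc r) (suc t) =
  pascalFamily 0ℚ 1ℚ id refl refl mulX₀ eval-mulX₀ DegLe-mulX₀
               (InΩ-0∷ {k = suc t}) (InΩ-1∷ {k = t}) (diagonalFamily r (suc t)) (diagonalFamily r t)

-- The split along 1 - x₀ needs t + 1 ≤ k for the part on x₀ = 1, so t = k is handled by the
-- diagonal family, which needs no bound on r.
sliceFamily : ∀ r t k → t ≤ k → t ℕ.+ k ≤ r → IndependentFamily r t k
sliceFamily r       zero    k       _   k≤r = constantFamily k≤r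
sliceFamily zero    (suc t) k       _   ()
sliceFamily (suc r) (suc t) zero    ()  _
sliceFamily (suc r) (suc t) (suc k) t≤k (s≤s t+k≤r) with t ℕ.≟ k
... | yes refl = diagonalFamily (suc r) (suc t)
... | no  t≢k  =
  pascalFamily 1ℚ 0ℚ (λ x₀ → 1ℚ - x₀) (ℚ.+-inverseʳ 1ℚ) refl
               mulOneMinusX₀ eval-mulOneMinusX₀ DegLe-mulOneMinusX₀
               (InΩ-1∷ {k = k}) (InΩ-0∷ {k = suc k})
               (sliceFamily r (suc t) k t<k (subst (_≤ r) (ℕ.+-suc t k) t+k≤r))
               (sliceFamily r t (suc k) (ℕ.m≤n⇒m≤1+n (ℕ.≤-pred t≤k)) t+k≤r)
  where
  t<k : suc t ≤ k
  t<k = ℕ.≤∧≢⇒< (ℕ.≤-pred t≤k) t≢k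

module _ {t k r n d : ℕ} {a b : Fin n → Vec ℚ r} {q : Fin d → Poly r}
         (a∈Ω : ∀ i → InΩ k (a i)) (b∈Ω : ∀ i → InΩ k (b i)) (pte : IsPTE (2 * t) a b)
         (q-basis : IsBasisPt t k q) (rank : HasRank (NANB q a b) d) where

  vanishing-on-A⇒vanishing-on-Ω : ∀ g → DegLe t g → (∀ i → eval g (a i) ≡ 0ℚ) →
                                   ∀ x → InΩ k x → eval g x ≡ 0ℚ
  vanishing-on-A⇒vanishing-on-Ω g g-deg g[a]≡0 x x∈Ω = begin
    eval g x                         ≡⟨ g≡c·q x x∈Ω ⟩
    Σℚ d (λ l → c l · eval (q l) x)  ≡⟨ Σℚ-zero d (λ l → p≡0⇒p·q≡0 (eval (q l) x) (c≡0 l)) ⟩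
    0ℚ                               ∎
    where
    open ≡-Reasoning
    g[b]≡0 : ∀ i → eval g (b i) ≡ 0ℚ
    g[b]≡0 = pte-vanishing pte g g-deg g[a]≡0
    c : Fin d → ℚ
    c = proj₁ (proj₂ (proj₂ q-basis) g g-deg)
    g≡c·q : ∀ x → InΩ k x → eval g x ≡ Σℚ d (λ l → c l · eval (q l) x)
    g≡c·q = proj₂ (proj₂ (proj₂ q-basis) g g-deg)
    columns : Fin d → Fin (n ℕ.+ n)
    columns = proj₁ (proj₁ rank)
    c⊥columns : ∀ m → Σℚ d (λ l → c l · NANB q a b l (columns m)) ≡ 0ℚ
    c⊥columns m with splitAt n (columns m)
    ... | inj₁ i = trans (sym (g≡c·q (a i) (a∈Ω i))) (g[a]≡0 i)
    ... | inj₂ i = trans (sym (g≡c·q (b i) (b∈Ω i))) (g[b]≡0 i)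
    c≡0 : ∀ l → c l ≡ 0ℚ
    c≡0 = orthogonal⇒≡0 (cols (NANB q a b) columns) (proj₂ (proj₁ rank)) c c⊥columns

  restriction-to-A-independent : (F : IndependentFamily r t k) → LinIndep (λ j i → eval (poly F j) (a i))
  restriction-to-A-independent F γ γ·F[a]≡0 = independent F γ (λ x x∈Ω →
    trans (sym (eval-linearCombination (size F) γ (poly F) x))
          (vanishing-on-A⇒vanishing-on-Ω g (DegLe-linearCombination (size F) γ (poly F) (poly-degree F))
                                          g[a]≡0 x x∈Ω))
    where
    g : Poly r
    g = linearCombination (size F) γ (poly F)
    g[a]≡0 : ∀ i → eval g (a i) ≡ 0ℚ
    g[a]≡0 i = trans (eval-linearCombination (size F) γ (poly F) (a i)) (γ·F[a]≡0 i)

corollary2p14 : (t k r : ℕ) → 1 ≤ t → 1 ≤ k → 1 ≤ r → t ≤ k → k ≤ r ∸ t →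
    (n : ℕ) (a b : Fin n → Vec ℚ r) →
    (∀ i → InΩ k (a i)) → (∀ i → InΩ k (b i)) →
    IsPTE (2 * t) a b → IsProper a b →
    (d : ℕ) (q : Fin d → Poly r) → IsBasisPt t k q →
    HasRank (NANB q a b) d →
    r C t ≤ n
corollary2p14 t k r _ _ _ t≤k k≤r∸t n a b a∈Ω b∈Ω pte _ d q q-basis rank =
  ℕ.≤-trans (binomial≤size F)
            (LinIndep⇒≤ _ (restriction-to-A-independent a∈Ω b∈Ω pte q-basis rank F))
  where
  t≤r : t ≤ r
  t≤r = ℕ.≤-trans t≤k (ℕ.≤-trans k≤r∸t (ℕ.m∸n≤m r t))
  t+k≤r : t ℕ.+ k ≤ r
  t+k≤r = subst (_≤ r) (ℕ.+-comm k t) (ℕ.m≤o∸n⇒m+n≤o k t≤r k≤r∸t)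
  F : IndependentFamily r t k
  F = sliceFamily r t k t≤k t+k≤r
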